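{- For every positive integer $m$ there exist explicitly computable constants $d>0$, $e_1$, $e_2$, depending only on $m$, such that the following holds. Let $k,n$ be positive integers with $k>2m(m+1)-1$ and $n>(m+1)k+d$, and let $u$ be the natural number whose binary expansion is \[ (u)_2=1^{(k)}\,0\,1^{(k+1)}\,0\,1^{(k+2)}\,0\cdots 0\,1^{(k+m)}\,0\,1^{(n)}. \] Then $s_2(u^2)=n-mk+e_1$ and $s_2(u)=n+k(m+1)+e_2$.
   Context: $s_2(n)$ denotes the sum of the binary digits of $n$. In a digit string, $x^{(a)}$ denotes the digit $x$ repeated $a$ times consecutively; the string is read from the most significant digit to the least significant. Thus $(u)_2$ consists of a block of $k$ ones, a zero, a block of $k+1$ ones, a zero, and so on up to a block of $k+m$ ones, a zero, and finally a block of $n$ ones. -}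

module Defs where

open import Data.Nat using (ℕ; zero; suc; _+_; _*_; _%_; _/_)
open import Data.Bool using (Bool; true; false)
open import Data.List using (List; []; _∷_; _++_; replicate; concatMap; upTo; foldl)

-- binary digit sum s₂(n): sum of n % 2 while halving; fuel n suffices since n < 2^n
s₂-fuel : ℕ → ℕ → ℕ
s₂-fuel zero    _ = 0
s₂-fuel (suc f) n = n % 2 + s₂-fuel f (n / 2)

s₂ : ℕ → ℕ
s₂ n = s₂-fuel n n

bitVal : Bool → ℕ
bitVal true  = 1
bitVal false = 0

fromBits : List Bool → ℕ
fromBits = foldl (λ acc b → 2 * acc + bitVal b) 0

uBits : ℕ → ℕ → ℕ → List Bool
uBits k m n =
  concatMap (λ i → replicate (k + i) true ++ (false ∷ [])) (upTo (suc m))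
  ++ replicate n true

u : ℕ → ℕ → ℕ → ℕ
u k m n = fromBits (uBits k m n)

module Submission where

-- Write q = 2 ^ k and let B be the value of the prefix 1^(k) 0 1^(k+1) 0 ⋯ 1^(k+m) 0 of (u)₂, so that u + 1 = D · 2 ^ n
-- with D = B + 1. Then s₂ u = s₂ B + n, and for n large
--   u ² = ((D ² − 1) · 2 ^ (n − 1) + (2 ^ (n − 1) − D)) · 2 ^ (n + 1) + 1
-- with non-overlapping pieces; the middle one is the complement of B, so s₂ (u ²) = n + s₂ (D ² − 1) − s₂ B.
-- As a polynomial in q, D_0 = 2q − 1 and D_(j+1) = 2 ^ (j + 2) · q · D_j − 1, and one finds D_m ² − 1 = T (q − 1) + R
-- with T a power of two and R < T a polynomial in q whose coefficients do not depend on k. Once k is large these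
-- coefficients are below q, so s₂ (D_m ² − 1) = k + the sum of the digit sums of the coefficients.

open import Defs
open import Data.Bool using (Bool; true; false)
open import Data.Empty using (⊥-elim)
open import Data.List using (List; []; _∷_; _++_; length; replicate; map; concat; concatMap; upTo; foldl)
open import Data.List.Properties using (foldl-++; length-++; length-replicate; upTo-∷ʳ; map-++; concat-++; ++-identityʳ)
open import Data.List.Relation.Unary.All as All using (All; []; _∷_)
open import Data.Nat
open import Data.Nat.ListAction using (sum)
open import Data.Nat.DivMod
open import Data.Nat.Properties
open import Data.Nat.Solver using (module +-*-Solver)
open import Data.Product using (Σ; ∃; _×_; _,_; proj₁; proj₂)
open import Function using (_∘_)
open import Relation.Binary.PropositionalEquality
open +-*-Solver using (solve; _:=_; _:+_; _:*_; con)

-- Binary digit sums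

n/2≤pred : ∀ f n → n ≤ suc f → n / 2 ≤ f
n/2≤pred f zero    _   = z≤n
n/2≤pred f (suc n) n≤ = <⇒≤pred (≤-trans (m/n<m (suc n) 2 (s≤s (s≤s z≤n))) n≤)

s₂-fuel-irrelevant : ∀ f g n → n ≤ f → n ≤ g → s₂-fuel f n ≡ s₂-fuel g n
s₂-fuel-irrelevant zero    zero    n       _   _   = refl
s₂-fuel-irrelevant zero    (suc g) zero    _   _   = s₂-fuel-irrelevant zero g 0 z≤n z≤n
s₂-fuel-irrelevant (suc f) zero    zero    _   _   = s₂-fuel-irrelevant f zero 0 z≤n z≤n
s₂-fuel-irrelevant (suc f) (suc g) n       n≤f n≤g =
  cong (n % 2 +_) (s₂-fuel-irrelevant f g (n / 2) (n/2≤pred f n n≤f) (n/2≤pred g n n≤g))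

s₂[n]≡n%2+s₂[n/2] : ∀ n → s₂ n ≡ n % 2 + s₂ (n / 2)
s₂[n]≡n%2+s₂[n/2] zero    = refl
s₂[n]≡n%2+s₂[n/2] (suc n) =
  cong (suc n % 2 +_) (s₂-fuel-irrelevant n (suc n / 2) (suc n / 2) (n/2≤pred n (suc n) ≤-refl) ≤-refl)

data LastBit : ℕ → Set where
  even : ∀ z → LastBit (z * 2)
  odd  : ∀ z → LastBit (1 + z * 2)

lastBit : ∀ n → LastBit n
lastBit zero = even 0
lastBit (suc n) with lastBit n
... | even z = odd z
... | odd z  = even (suc z)

s₂[n*2]≡s₂[n] : ∀ n → s₂ (n * 2) ≡ s₂ n
s₂[n*2]≡s₂[n] n = trans (s₂[n]≡n%2+s₂[n/2] (n * 2)) (cong₂ _+_ (m*n%n≡0 n 2) (cong s₂ (m*n/n≡m n 2)))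

s₂[1+n*2]≡1+s₂[n] : ∀ n → s₂ (1 + n * 2) ≡ 1 + s₂ n
s₂[1+n*2]≡1+s₂[n] n = trans (s₂[n]≡n%2+s₂[n/2] (1 + n * 2)) (cong₂ _+_ ([m+kn]%n≡m%n 1 n 2) (cong s₂ [1+n*2]/2≡n))
  where
  [1+n*2]/2≡n : (1 + n * 2) / 2 ≡ n
  [1+n*2]/2≡n = trans (+-distrib-/ 1 (n * 2) (subst (λ r → 1 + r < 2) (sym (m*n%n≡0 n 2)) ≤-refl)) (m*n/n≡m n 2)

s₂[x*2^t+y]≡s₂[x]+s₂[y] : ∀ t x y → y < 2 ^ t → s₂ (x * 2 ^ t + y) ≡ s₂ x + s₂ y
s₂[x*2^t+y]≡s₂[x]+s₂[y] zero x zero _ = trans (cong s₂ (trans (+-identityʳ _) (*-identityʳ x))) (sym (+-identityʳ _))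
s₂[x*2^t+y]≡s₂[x]+s₂[y] zero x (suc y) (s≤s ())
s₂[x*2^t+y]≡s₂[x]+s₂[y] (suc t) x y y< with lastBit y
... | even z = begin
  s₂ (x * 2 ^ suc t + z * 2) ≡⟨ cong s₂ (solve 3 (λ x p z → x :* (con 2 :* p) :+ z :* con 2 := (x :* p :+ z) :* con 2) refl x (2 ^ t) z) ⟩
  s₂ ((x * 2 ^ t + z) * 2)   ≡⟨ s₂[n*2]≡s₂[n] (x * 2 ^ t + z) ⟩
  s₂ (x * 2 ^ t + z)         ≡⟨ s₂[x*2^t+y]≡s₂[x]+s₂[y] t x z (halve y<) ⟩
  s₂ x + s₂ z                ≡⟨ cong (s₂ x +_) (s₂[n*2]≡s₂[n] z) ⟨
  s₂ x + s₂ (z * 2)          ∎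
  where
  open ≡-Reasoning
  halve : z * 2 < 2 ^ suc t → z < 2 ^ t
  halve lt = *-cancelʳ-< 2 z (2 ^ t) (subst (z * 2 <_) (*-comm 2 (2 ^ t)) lt)
... | odd z = begin
  s₂ (x * 2 ^ suc t + (1 + z * 2)) ≡⟨ cong s₂ (solve 3 (λ x p z → x :* (con 2 :* p) :+ (con 1 :+ z :* con 2) := con 1 :+ (x :* p :+ z) :* con 2) refl x (2 ^ t) z) ⟩
  s₂ (1 + (x * 2 ^ t + z) * 2)     ≡⟨ s₂[1+n*2]≡1+s₂[n] (x * 2 ^ t + z) ⟩
  1 + s₂ (x * 2 ^ t + z)           ≡⟨ cong suc (s₂[x*2^t+y]≡s₂[x]+s₂[y] t x z (halve y<)) ⟩
  1 + (s₂ x + s₂ z)                ≡⟨ +-suc (s₂ x) (s₂ z) ⟨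
  s₂ x + (1 + s₂ z)                ≡⟨ cong (s₂ x +_) (s₂[1+n*2]≡1+s₂[n] z) ⟨
  s₂ x + s₂ (1 + z * 2)            ∎
  where
  open ≡-Reasoning
  halve : 1 + z * 2 < 2 ^ suc t → z < 2 ^ t
  halve lt = *-cancelʳ-< 2 z (2 ^ t) (subst (z * 2 <_) (*-comm 2 (2 ^ t)) (<-trans (n<1+n _) lt))

1+n*2≢m*2 : ∀ n m → 1 + n * 2 ≢ m * 2
1+n*2≢m*2 n m eq = 1≢0 (begin
  1               ≡⟨ [m+kn]%n≡m%n 1 n 2 ⟨
  (1 + n * 2) % 2 ≡⟨ cong (_% 2) eq ⟩
  m * 2 % 2       ≡⟨ m*n%n≡0 m 2 ⟩
  0               ∎)
  where
  open ≡-Reasoning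
  1≢0 : 1 ≢ 0
  1≢0 ()

b+w+1≡2^t⇒s₂[b]+s₂[w]≡t : ∀ t b w → b + w + 1 ≡ 2 ^ t → s₂ b + s₂ w ≡ t
b+w+1≡2^t⇒s₂[b]+s₂[w]≡t zero b w eq
  rewrite m+n≡0⇒m≡0 b (+-cancelʳ-≡ 1 (b + w) 0 eq)
        | m+n≡0⇒n≡0 b (+-cancelʳ-≡ 1 (b + w) 0 eq) = refl
b+w+1≡2^t⇒s₂[b]+s₂[w]≡t (suc t) b w eq with lastBit b | lastBit w
... | even b' | even w' = ⊥-elim (1+n*2≢m*2 (b' + w') (2 ^ t) (begin
  1 + (b' + w') * 2     ≡⟨ solve 2 (λ b w → con 1 :+ (b :+ w) :* con 2 := b :* con 2 :+ w :* con 2 :+ con 1) refl b' w' ⟩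
  b' * 2 + w' * 2 + 1   ≡⟨ eq ⟩
  2 * 2 ^ t             ≡⟨ *-comm 2 (2 ^ t) ⟩
  2 ^ t * 2             ∎))
  where open ≡-Reasoning
... | odd b' | odd w' = ⊥-elim (1+n*2≢m*2 (b' + w' + 1) (2 ^ t) (begin
  1 + (b' + w' + 1) * 2               ≡⟨ solve 2 (λ b w → con 1 :+ (b :+ w :+ con 1) :* con 2 := con 1 :+ b :* con 2 :+ (con 1 :+ w :* con 2) :+ con 1) refl b' w' ⟩
  1 + b' * 2 + (1 + w' * 2) + 1       ≡⟨ eq ⟩
  2 * 2 ^ t                           ≡⟨ *-comm 2 (2 ^ t) ⟩
  2 ^ t * 2                           ∎))
  where open ≡-Reasoning
... | even b' | odd w' = begin
  s₂ (b' * 2) + s₂ (1 + w' * 2) ≡⟨ cong₂ _+_ (s₂[n*2]≡s₂[n] b') (s₂[1+n*2]≡1+s₂[n] w') ⟩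
  s₂ b' + (1 + s₂ w')           ≡⟨ +-suc (s₂ b') (s₂ w') ⟩
  1 + (s₂ b' + s₂ w')           ≡⟨ cong suc (b+w+1≡2^t⇒s₂[b]+s₂[w]≡t t b' w' (*-cancelʳ-≡ _ _ 2 (begin
    (b' + w' + 1) * 2             ≡⟨ solve 2 (λ b w → (b :+ w :+ con 1) :* con 2 := b :* con 2 :+ (con 1 :+ w :* con 2) :+ con 1) refl b' w' ⟩
    b' * 2 + (1 + w' * 2) + 1     ≡⟨ eq ⟩
    2 * 2 ^ t                     ≡⟨ *-comm 2 (2 ^ t) ⟩
    2 ^ t * 2                     ∎))) ⟩
  suc t                         ∎
  where open ≡-Reasoning
... | odd b' | even w' = begin
  s₂ (1 + b' * 2) + s₂ (w' * 2) ≡⟨ cong₂ _+_ (s₂[1+n*2]≡1+s₂[n] b') (s₂[n*2]≡s₂[n] w') ⟩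
  1 + (s₂ b' + s₂ w')           ≡⟨ cong suc (b+w+1≡2^t⇒s₂[b]+s₂[w]≡t t b' w' (*-cancelʳ-≡ _ _ 2 (begin
    (b' + w' + 1) * 2             ≡⟨ solve 2 (λ b w → (b :+ w :+ con 1) :* con 2 := (con 1 :+ b :* con 2) :+ w :* con 2 :+ con 1) refl b' w' ⟩
    1 + b' * 2 + w' * 2 + 1       ≡⟨ eq ⟩
    2 * 2 ^ t                     ≡⟨ *-comm 2 (2 ^ t) ⟩
    2 ^ t * 2                     ∎))) ⟩
  suc t                         ∎
  where open ≡-Reasoning

w+1≡2^t⇒s₂[w]≡t : ∀ t w → w + 1 ≡ 2 ^ t → s₂ w ≡ t
w+1≡2^t⇒s₂[w]≡t t w = b+w+1≡2^t⇒s₂[b]+s₂[w]≡t t 0 w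

-- Binary strings

pushBit : ℕ → Bool → ℕ
pushBit acc b = 2 * acc + bitVal b

foldl-pushBit : ∀ acc bs → foldl pushBit acc bs ≡ acc * 2 ^ length bs + fromBits bs
foldl-pushBit acc []       = sym (trans (+-identityʳ _) (*-identityʳ acc))
foldl-pushBit acc (b ∷ bs) = begin
  foldl pushBit (pushBit acc b) bs                             ≡⟨ foldl-pushBit (pushBit acc b) bs ⟩
  (2 * acc + bitVal b) * 2 ^ length bs + fromBits bs           ≡⟨ solve 4 (λ a b p f → (con 2 :* a :+ b) :* p :+ f := a :* (con 2 :* p) :+ (b :* p :+ f)) refl acc (bitVal b) (2 ^ length bs) (fromBits bs) ⟩
  acc * 2 ^ length (b ∷ bs) + (bitVal b * 2 ^ length bs + fromBits bs) ≡⟨ cong (acc * 2 ^ length (b ∷ bs) +_) (foldl-pushBit (bitVal b) bs) ⟨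
  acc * 2 ^ length (b ∷ bs) + fromBits (b ∷ bs)                ∎
  where open ≡-Reasoning

fromBits-++ : ∀ bs cs → fromBits (bs ++ cs) ≡ fromBits bs * 2 ^ length cs + fromBits cs
fromBits-++ bs cs = trans (foldl-++ pushBit 0 bs cs) (foldl-pushBit (fromBits bs) cs)

fromBits<2^length : ∀ bs → fromBits bs < 2 ^ length bs
fromBits<2^length []       = s≤s z≤n
fromBits<2^length (b ∷ bs) = begin-strict
  fromBits (b ∷ bs)                      ≡⟨ foldl-pushBit (bitVal b) bs ⟩
  bitVal b * 2 ^ length bs + fromBits bs <⟨ +-monoʳ-< (bitVal b * 2 ^ length bs) (fromBits<2^length bs) ⟩
  bitVal b * 2 ^ length bs + 2 ^ length bs ≤⟨ +-monoˡ-≤ (2 ^ length bs) (*-monoˡ-≤ (2 ^ length bs) (bitVal≤1 b)) ⟩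
  1 * 2 ^ length bs + 2 ^ length bs      ≡⟨ solve 1 (λ p → con 1 :* p :+ p := con 2 :* p) refl (2 ^ length bs) ⟩
  2 ^ length (b ∷ bs)                    ∎
  where
  open ≤-Reasoning
  bitVal≤1 : ∀ b → bitVal b ≤ 1
  bitVal≤1 true  = ≤-refl
  bitVal≤1 false = z≤n

s₂-fromBits-++ : ∀ bs cs → s₂ (fromBits (bs ++ cs)) ≡ s₂ (fromBits bs) + s₂ (fromBits cs)
s₂-fromBits-++ bs cs = trans (cong s₂ (fromBits-++ bs cs))
  (s₂[x*2^t+y]≡s₂[x]+s₂[y] (length cs) (fromBits bs) (fromBits cs) (fromBits<2^length cs))

fromBits-ones : ∀ n → fromBits (replicate n true) + 1 ≡ 2 ^ n
fromBits-ones zero    = refl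
fromBits-ones (suc n) = begin
  fromBits (replicate (suc n) true) + 1                  ≡⟨ cong (_+ 1) (foldl-pushBit 1 (replicate n true)) ⟩
  1 * 2 ^ length (replicate n true) + ones + 1          ≡⟨ cong (λ l → 1 * 2 ^ l + ones + 1) (length-replicate n) ⟩
  1 * 2 ^ n + ones + 1                                  ≡⟨ solve 2 (λ p f → con 1 :* p :+ f :+ con 1 := p :+ (f :+ con 1)) refl (2 ^ n) ones ⟩
  2 ^ n + (ones + 1)                                    ≡⟨ cong (2 ^ n +_) (fromBits-ones n) ⟩
  2 ^ n + 2 ^ n                                         ≡⟨ solve 1 (λ p → p :+ p := con 2 :* p) refl (2 ^ n) ⟩
  2 ^ suc n                                             ∎
  where
  open ≡-Reasoning
  ones = fromBits (replicate n true)

s₂-fromBits-ones : ∀ n → s₂ (fromBits (replicate n true)) ≡ n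
s₂-fromBits-ones n = w+1≡2^t⇒s₂[w]≡t n _ (fromBits-ones n)

-- The digit string of u

block : ℕ → ℕ → List Bool
block k i = replicate (k + i) true ++ false ∷ []

blocks : ℕ → ℕ → List Bool
blocks k m = concatMap (block k) (upTo (suc m))

blocks-zero : ∀ k → blocks k 0 ≡ block k 0
blocks-zero k = ++-identityʳ (block k 0)

blocks-suc : ∀ k m → blocks k (suc m) ≡ blocks k m ++ block k (suc m)
blocks-suc k m = begin
  concat (map (block k) (upTo (suc (suc m))))                  ≡⟨ cong (concat ∘ map (block k)) (upTo-∷ʳ (suc m)) ⟨
  concat (map (block k) (upTo (suc m) ++ suc m ∷ []))          ≡⟨ cong concat (map-++ (block k) (upTo (suc m)) (suc m ∷ [])) ⟩
  concat (map (block k) (upTo (suc m)) ++ block k (suc m) ∷ []) ≡⟨ concat-++ (map (block k) (upTo (suc m))) (block k (suc m) ∷ []) ⟨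
  blocks k m ++ block k (suc m) ++ []                          ≡⟨ cong (blocks k m ++_) (++-identityʳ (block k (suc m))) ⟩
  blocks k m ++ block k (suc m)                                ∎
  where open ≡-Reasoning

fromBits-block : ∀ k i → fromBits (block k i) + 2 ≡ 2 * 2 ^ (k + i)
fromBits-block k i = begin
  fromBits (block k i) + 2      ≡⟨ cong (_+ 2) (fromBits-++ (replicate (k + i) true) (false ∷ [])) ⟩
  ones * 2 + 0 + 2              ≡⟨ solve 1 (λ x → x :* con 2 :+ con 0 :+ con 2 := con 2 :* (x :+ con 1)) refl ones ⟩
  2 * (ones + 1)                ≡⟨ cong (2 *_) (fromBits-ones (k + i)) ⟩
  2 * 2 ^ (k + i)               ∎
  where
  open ≡-Reasoning
  ones = fromBits (replicate (k + i) true)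

length-block : ∀ k i → length (block k i) ≡ suc (k + i)
length-block k i = begin
  length (block k i)                          ≡⟨ length-++ (replicate (k + i) true) ⟩
  length (replicate (k + i) true) + 1         ≡⟨ cong (_+ 1) (length-replicate (k + i)) ⟩
  k + i + 1                                   ≡⟨ +-comm (k + i) 1 ⟩
  suc (k + i)                                 ∎
  where open ≡-Reasoning

s₂-block : ∀ k i → s₂ (fromBits (block k i)) ≡ k + i
s₂-block k i = begin
  s₂ (fromBits (block k i))                    ≡⟨ s₂-fromBits-++ (replicate (k + i) true) (false ∷ []) ⟩
  s₂ (fromBits (replicate (k + i) true)) + 0   ≡⟨ +-identityʳ _ ⟩
  s₂ (fromBits (replicate (k + i) true))       ≡⟨ s₂-fromBits-ones (k + i) ⟩
  k + i                                        ∎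
  where open ≡-Reasoning

triangle : ℕ → ℕ
triangle zero    = 0
triangle (suc m) = suc m + triangle m

length-blocks : ∀ k m → length (blocks k m) ≡ suc m * k + (suc m + triangle m)
length-blocks k zero = begin
  length (blocks k 0)   ≡⟨ cong length (blocks-zero k) ⟩
  length (block k 0)    ≡⟨ length-block k 0 ⟩
  suc (k + 0)           ≡⟨ solve 1 (λ k → con 1 :+ (k :+ con 0) := (con 1 :+ con 0) :* k :+ (con 1 :+ con 0)) refl k ⟩
  1 * k + (1 + 0)       ∎
  where open ≡-Reasoning
length-blocks k (suc m) = begin
  length (blocks k (suc m))                         ≡⟨ cong length (blocks-suc k m) ⟩
  length (blocks k m ++ block k (suc m))            ≡⟨ length-++ (blocks k m) ⟩
  length (blocks k m) + length (block k (suc m))    ≡⟨ cong₂ _+_ (length-blocks k m) (length-block k (suc m)) ⟩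
  suc m * k + (suc m + triangle m) + suc (k + suc m) ≡⟨ solve 3 (λ m k t → (con 1 :+ m) :* k :+ ((con 1 :+ m) :+ t) :+ (con 1 :+ (k :+ (con 1 :+ m))) := (con 2 :+ m) :* k :+ ((con 2 :+ m) :+ ((con 1 :+ m) :+ t))) refl m k (triangle m) ⟩
  suc (suc m) * k + (suc (suc m) + triangle (suc m)) ∎
  where open ≡-Reasoning

B : ℕ → ℕ → ℕ
B k m = fromBits (blocks k m)

D : ℕ → ℕ → ℕ
D k m = suc (B k m)

s₂-B : ∀ k m → s₂ (B k m) ≡ suc m * k + triangle m
s₂-B k zero = begin
  s₂ (fromBits (blocks k 0)) ≡⟨ cong (s₂ ∘ fromBits) (blocks-zero k) ⟩
  s₂ (fromBits (block k 0))  ≡⟨ s₂-block k 0 ⟩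
  k + 0                      ≡⟨ solve 1 (λ k → k :+ con 0 := (con 1 :+ con 0) :* k :+ con 0) refl k ⟩
  1 * k + 0                  ∎
  where open ≡-Reasoning
s₂-B k (suc m) = begin
  s₂ (fromBits (blocks k (suc m)))                        ≡⟨ cong (s₂ ∘ fromBits) (blocks-suc k m) ⟩
  s₂ (fromBits (blocks k m ++ block k (suc m)))           ≡⟨ s₂-fromBits-++ (blocks k m) (block k (suc m)) ⟩
  s₂ (B k m) + s₂ (fromBits (block k (suc m)))            ≡⟨ cong₂ _+_ (s₂-B k m) (s₂-block k (suc m)) ⟩
  suc m * k + triangle m + (k + suc m)                    ≡⟨ solve 3 (λ m k t → (con 1 :+ m) :* k :+ t :+ (k :+ (con 1 :+ m)) := (con 2 :+ m) :* k :+ ((con 1 :+ m) :+ t)) refl m k (triangle m) ⟩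
  suc (suc m) * k + triangle (suc m)                      ∎
  where open ≡-Reasoning

D-zero : ∀ k → D k 0 + 1 ≡ 2 * 2 ^ k
D-zero k = begin
  D k 0 + 1                ≡⟨ +-suc (B k 0) 1 ⟨
  fromBits (blocks k 0) + 2 ≡⟨ cong (λ bs → fromBits bs + 2) (blocks-zero k) ⟩
  fromBits (block k 0) + 2  ≡⟨ fromBits-block k 0 ⟩
  2 * 2 ^ (k + 0)           ≡⟨ cong (λ i → 2 * 2 ^ i) (+-identityʳ k) ⟩
  2 * 2 ^ k                 ∎
  where open ≡-Reasoning

D-suc : ∀ k m → D k (suc m) + 1 ≡ 2 ^ k * (2 ^ suc (suc m) * D k m)
D-suc k m = begin
  D k (suc m) + 1                                           ≡⟨ +-suc (B k (suc m)) 1 ⟨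
  fromBits (blocks k (suc m)) + 2                           ≡⟨ cong (λ bs → fromBits bs + 2) (blocks-suc k m) ⟩
  fromBits (blocks k m ++ block k (suc m)) + 2              ≡⟨ cong (_+ 2) (fromBits-++ (blocks k m) (block k (suc m))) ⟩
  B k m * 2 ^ length (block k (suc m)) + b + 2              ≡⟨ cong (λ l → B k m * 2 ^ l + b + 2) (length-block k (suc m)) ⟩
  B k m * (2 * 2 ^ (k + suc m)) + b + 2                     ≡⟨ +-assoc (B k m * (2 * 2 ^ (k + suc m))) b 2 ⟩
  B k m * (2 * 2 ^ (k + suc m)) + (b + 2)                   ≡⟨ cong (B k m * (2 * 2 ^ (k + suc m)) +_) (fromBits-block k (suc m)) ⟩
  B k m * (2 * 2 ^ (k + suc m)) + 2 * 2 ^ (k + suc m)       ≡⟨ cong (λ p → B k m * (2 * p) + 2 * p) (^-distribˡ-+-* 2 k (suc m)) ⟩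
  B k m * (2 * (2 ^ k * 2 ^ suc m)) + 2 * (2 ^ k * 2 ^ suc m) ≡⟨ solve 3 (λ b q r → b :* (con 2 :* (q :* r)) :+ con 2 :* (q :* r) := q :* (con 2 :* r :* (con 1 :+ b))) refl (B k m) (2 ^ k) (2 ^ suc m) ⟩
  2 ^ k * (2 ^ suc (suc m) * D k m)                         ∎
  where
  open ≡-Reasoning
  b = fromBits (block k (suc m))

u≡B*2^n+ones : ∀ k m n → u k m n ≡ B k m * 2 ^ n + fromBits (replicate n true)
u≡B*2^n+ones k m n = trans (fromBits-++ (blocks k m) (replicate n true))
  (cong (λ l → B k m * 2 ^ l + fromBits (replicate n true)) (length-replicate n))

u+1≡D*2^n : ∀ k m n → u k m n + 1 ≡ D k m * 2 ^ n
u+1≡D*2^n k m n = begin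
  u k m n + 1                                        ≡⟨ cong (_+ 1) (u≡B*2^n+ones k m n) ⟩
  B k m * 2 ^ n + fromBits (replicate n true) + 1    ≡⟨ +-assoc (B k m * 2 ^ n) _ 1 ⟩
  B k m * 2 ^ n + (fromBits (replicate n true) + 1)  ≡⟨ cong (B k m * 2 ^ n +_) (fromBits-ones n) ⟩
  B k m * 2 ^ n + 2 ^ n                              ≡⟨ solve 2 (λ b p → b :* p :+ p := (con 1 :+ b) :* p) refl (B k m) (2 ^ n) ⟩
  D k m * 2 ^ n                                      ∎
  where open ≡-Reasoning

-- Polynomials with natural coefficients

Poly : Set
Poly = List ℕ

⟦_⟧ : Poly → ℕ → ℕ
⟦ []    ⟧ q = 0
⟦ c ∷ p ⟧ q = c + q * ⟦ p ⟧ q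

scale : ℕ → Poly → Poly
scale c = map (c *_)

infixl 6 _⊕_
_⊕_ : Poly → Poly → Poly
[]      ⊕ r       = r
(c ∷ p) ⊕ []      = c ∷ p
(c ∷ p) ⊕ (d ∷ r) = c + d ∷ p ⊕ r

⟦scale⟧ : ∀ c p q → ⟦ scale c p ⟧ q ≡ c * ⟦ p ⟧ q
⟦scale⟧ c []      q = sym (*-zeroʳ c)
⟦scale⟧ c (x ∷ p) q = begin
  c * x + q * ⟦ scale c p ⟧ q ≡⟨ cong (λ e → c * x + q * e) (⟦scale⟧ c p q) ⟩
  c * x + q * (c * ⟦ p ⟧ q)   ≡⟨ solve 4 (λ c x q e → c :* x :+ q :* (c :* e) := c :* (x :+ q :* e)) refl c x q (⟦ p ⟧ q) ⟩
  c * (x + q * ⟦ p ⟧ q)       ∎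
  where open ≡-Reasoning

⟦⊕⟧ : ∀ p r q → ⟦ p ⊕ r ⟧ q ≡ ⟦ p ⟧ q + ⟦ r ⟧ q
⟦⊕⟧ []      r       q = refl
⟦⊕⟧ (c ∷ p) []      q = sym (+-identityʳ _)
⟦⊕⟧ (c ∷ p) (d ∷ r) q = begin
  c + d + q * ⟦ p ⊕ r ⟧ q                 ≡⟨ cong (λ e → c + d + q * e) (⟦⊕⟧ p r q) ⟩
  c + d + q * (⟦ p ⟧ q + ⟦ r ⟧ q)         ≡⟨ solve 5 (λ c d q a b → c :+ d :+ q :* (a :+ b) := c :+ q :* a :+ (d :+ q :* b)) refl c d q (⟦ p ⟧ q) (⟦ r ⟧ q) ⟩
  c + q * ⟦ p ⟧ q + (d + q * ⟦ r ⟧ q)     ∎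
  where open ≡-Reasoning

coefficients≤⟦⟧1 : ∀ p → All (_≤ ⟦ p ⟧ 1) p
coefficients≤⟦⟧1 []      = []
coefficients≤⟦⟧1 (c ∷ p) = m≤m+n c _ ∷ All.map (λ x≤ → ≤-trans x≤ (≤-trans (≤-reflexive (sym (*-identityˡ _))) (m≤n+m _ c))) (coefficients≤⟦⟧1 p)

-- With all coefficients below 2 ^ k, evaluating at 2 ^ k just concatenates their binary expansions.
s₂-⟦⟧ : ∀ k p → All (_< 2 ^ k) p → s₂ (⟦ p ⟧ (2 ^ k)) ≡ sum (map s₂ p)
s₂-⟦⟧ k []      []         = refl
s₂-⟦⟧ k (c ∷ p) (c< ∷ p<) = begin
  s₂ (c + 2 ^ k * ⟦ p ⟧ (2 ^ k))   ≡⟨ cong s₂ (solve 3 (λ c q e → c :+ q :* e := e :* q :+ c) refl c (2 ^ k) (⟦ p ⟧ (2 ^ k))) ⟩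
  s₂ (⟦ p ⟧ (2 ^ k) * 2 ^ k + c)   ≡⟨ s₂[x*2^t+y]≡s₂[x]+s₂[y] k (⟦ p ⟧ (2 ^ k)) c c< ⟩
  s₂ (⟦ p ⟧ (2 ^ k)) + s₂ c        ≡⟨ +-comm _ (s₂ c) ⟩
  s₂ c + s₂ (⟦ p ⟧ (2 ^ k))        ≡⟨ cong (s₂ c +_) (s₂-⟦⟧ k p p<) ⟩
  s₂ c + sum (map s₂ p)            ∎
  where open ≡-Reasoning

-- D k m = (2 q − 1) · Y k m − Z k m as polynomials in q = 2 ^ k (see D+Z+Y≡2qY).
Ypoly : ℕ → Poly
Ypoly zero    = 1 ∷ []
Ypoly (suc m) = 0 ∷ scale (2 ^ suc (suc m)) (Ypoly m)

Zpoly : ℕ → Poly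
Zpoly zero    = []
Zpoly (suc m) = 1 ∷ scale (2 ^ suc (suc m)) (Zpoly m)

Y : ℕ → ℕ → ℕ
Y k m = ⟦ Ypoly m ⟧ (2 ^ k)

Z : ℕ → ℕ → ℕ
Z k m = ⟦ Zpoly m ⟧ (2 ^ k)

Y-suc : ∀ k m → Y k (suc m) ≡ 2 ^ k * (2 ^ suc (suc m) * Y k m)
Y-suc k m = cong (2 ^ k *_) (⟦scale⟧ (2 ^ suc (suc m)) (Ypoly m) (2 ^ k))

Z-suc : ∀ k m → Z k (suc m) ≡ 1 + 2 ^ k * (2 ^ suc (suc m) * Z k m)
Z-suc k m = cong (λ e → 1 + 2 ^ k * e) (⟦scale⟧ (2 ^ suc (suc m)) (Zpoly m) (2 ^ k))

Y-power-of-2 : ∀ k m → ∃ λ e → Y k m ≡ 2 ^ e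
Y-power-of-2 k zero    = 0 , cong suc (*-zeroʳ (2 ^ k))
Y-power-of-2 k (suc m) with Y-power-of-2 k m
... | e , Y≡2^e = k + (suc (suc m) + e) , (begin
  Y k (suc m)                              ≡⟨ Y-suc k m ⟩
  2 ^ k * (2 ^ suc (suc m) * Y k m)        ≡⟨ cong (λ y → 2 ^ k * (2 ^ suc (suc m) * y)) Y≡2^e ⟩
  2 ^ k * (2 ^ suc (suc m) * 2 ^ e)        ≡⟨ cong (2 ^ k *_) (^-distribˡ-+-* 2 (suc (suc m)) e) ⟨
  2 ^ k * 2 ^ (suc (suc m) + e)            ≡⟨ ^-distribˡ-+-* 2 k (suc (suc m) + e) ⟨
  2 ^ (k + (suc (suc m) + e))              ∎)
  where open ≡-Reasoning

D+Z+Y≡2qY : ∀ k m → D k m + (Z k m + Y k m) ≡ 2 * 2 ^ k * Y k m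
D+Z+Y≡2qY k zero = begin
  D k 0 + (0 + (1 + 2 ^ k * 0)) ≡⟨ cong (λ y → D k 0 + suc y) (*-zeroʳ (2 ^ k)) ⟩
  D k 0 + 1                     ≡⟨ D-zero k ⟩
  2 * 2 ^ k                     ≡⟨ solve 1 (λ q → con 2 :* q := con 2 :* q :* (con 1 :+ q :* con 0)) refl (2 ^ k) ⟩
  2 * 2 ^ k * (1 + 2 ^ k * 0)   ∎
  where open ≡-Reasoning
D+Z+Y≡2qY k (suc m) = begin
  D k (suc m) + (Z k (suc m) + Y k (suc m))          ≡⟨ cong₂ (λ z y → D k (suc m) + (z + y)) (Z-suc k m) (Y-suc k m) ⟩
  D k (suc m) + (1 + q * (c * Z k m) + q * (c * Y k m)) ≡⟨ solve 5 (λ d q c z y → d :+ (con 1 :+ q :* (c :* z) :+ q :* (c :* y)) := d :+ con 1 :+ q :* (c :* (z :+ y))) refl (D k (suc m)) q c (Z k m) (Y k m) ⟩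
  D k (suc m) + 1 + q * (c * (Z k m + Y k m))        ≡⟨ cong (_+ q * (c * (Z k m + Y k m))) (D-suc k m) ⟩
  q * (c * D k m) + q * (c * (Z k m + Y k m))        ≡⟨ solve 5 (λ q c d z y → q :* (c :* d) :+ q :* (c :* (z :+ y)) := q :* (c :* (d :+ (z :+ y)))) refl q c (D k m) (Z k m) (Y k m) ⟩
  q * (c * (D k m + (Z k m + Y k m)))                ≡⟨ cong (λ e → q * (c * e)) (D+Z+Y≡2qY k m) ⟩
  q * (c * (2 * q * Y k m))                          ≡⟨ solve 3 (λ q c y → q :* (c :* (con 2 :* q :* y)) := con 2 :* q :* (q :* (c :* y))) refl q c (Y k m) ⟩
  2 * q * (q * (c * Y k m))                          ≡⟨ cong (2 * q *_) (Y-suc k m) ⟨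
  2 * q * Y k (suc m)                                ∎
  where
  open ≡-Reasoning
  q = 2 ^ k
  c = 2 ^ suc (suc m)

-- The square of D

-- The identities below hold modulo their hypotheses; adding to both sides a combination of the
-- hypotheses (the terms x and y given to +-cancel) leaves a polynomial identity for the ring solver.
+-cancel : ∀ {a b x y} → a + x ≡ b + y → x ≡ y → a ≡ b
+-cancel {a} {b} {x} a+x≡b+x refl = +-cancelʳ-≡ x a b a+x≡b+x

square-base-identity : ∀ q d₀ d₁ y → d₀ + 1 ≡ 2 * q → d₁ + 1 ≡ q * (4 * d₀) → y ≡ q * 4 →
  d₁ * d₁ + 4 * q * (y * y) ≡ 4 * q * (y * y) * q + 0 + 2 * y + 1
square-base-identity q d₀ d₁ y h₀ h₁ refl = +-cancel {x = X} {y = X′} polynomial (swap h₁ h₀)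
  where
  P = d₁ + q * (4 * d₀)
  Q = 16 * (q * q) * d₀ + 32 * (q * (q * q))
  R = 16 * (q * q) + 8 * q
  X = P * (q * (4 * d₀)) + (d₁ + 1) + (Q * (2 * q) + R * (d₀ + 1))
  X′ = P * (d₁ + 1) + q * (4 * d₀) + (Q * (d₀ + 1) + R * (2 * q))
  swap : ∀ {l₁ r₁ l₀ r₀} → l₁ ≡ r₁ → l₀ ≡ r₀ → P * r₁ + l₁ + (Q * r₀ + R * l₀) ≡ P * l₁ + r₁ + (Q * l₀ + R * r₀)
  swap refl refl = refl
  polynomial : d₁ * d₁ + 4 * q * ((q * 4) * (q * 4)) + X ≡ 4 * q * ((q * 4) * (q * 4)) * q + 0 + 2 * (q * 4) + 1 + X′
  polynomial = solve 3 (λ q d₀ d₁ →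
    let P = d₁ :+ q :* (con 4 :* d₀)
        Q = con 16 :* (q :* q) :* d₀ :+ con 32 :* (q :* (q :* q))
        R = con 16 :* (q :* q) :+ con 8 :* q
        y = q :* con 4 in
    d₁ :* d₁ :+ con 4 :* q :* (y :* y) :+ (P :* (q :* (con 4 :* d₀)) :+ (d₁ :+ con 1) :+ (Q :* (con 2 :* q) :+ R :* (d₀ :+ con 1)))
    := con 4 :* q :* (y :* y) :* q :+ con 0 :+ con 2 :* y :+ con 1 :+ (P :* (d₁ :+ con 1) :+ q :* (con 4 :* d₀) :+ (Q :* (d₀ :+ con 1) :+ R :* (con 2 :* q)))) refl q d₀ d₁

square-step-identity : ∀ q c h d d′ z y s t → c ≡ 2 * (h + 1) → d′ + 1 ≡ q * (c * d) → d + (z + y) ≡ 2 * q * y →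
  d * d + t ≡ t * q + s + 2 * y + 1 →
  d′ * d′ + c * c * (q * (q * t)) ≡ c * c * (q * (q * t)) * q + (q * (q * (c * c * s)) + q * (q * (c * c)) + q * (2 * c * z) + q * (4 * h * (q * (c * y)))) + 2 * (q * (c * y)) + 1
square-step-identity q c h d d′ z y s t refl h₁ h₂ h₃ = +-cancel {x = X} {y = X′} polynomial (swap h₁ h₂ h₃)
  where
  A = 2 * (h + 1) * q
  X = (d′ + A * d) * (q * (2 * (h + 1) * d)) + (d′ + 1) + A * A * (t * q + s + 2 * y + 1) + 2 * A * (d + (z + y))
  X′ = (d′ + A * d) * (d′ + 1) + q * (2 * (h + 1) * d) + A * A * (d * d + t) + 2 * A * (2 * q * y)
  swap : ∀ {l₁ r₁ l₂ r₂ l₃ r₃} → l₁ ≡ r₁ → l₂ ≡ r₂ → l₃ ≡ r₃ →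
    (d′ + A * d) * r₁ + l₁ + A * A * r₃ + 2 * A * l₂ ≡ (d′ + A * d) * l₁ + r₁ + A * A * l₃ + 2 * A * r₂
  swap refl refl refl = refl
  c′ = 2 * (h + 1)
  polynomial : d′ * d′ + c′ * c′ * (q * (q * t)) + X ≡ c′ * c′ * (q * (q * t)) * q + (q * (q * (c′ * c′ * s)) + q * (q * (c′ * c′)) + q * (2 * c′ * z) + q * (4 * h * (q * (c′ * y)))) + 2 * (q * (c′ * y)) + 1 + X′
  polynomial = solve 8 (λ q h d d′ z y s t →
    let A = con 2 :* (h :+ con 1) :* q
        c = con 2 :* (h :+ con 1) in
    d′ :* d′ :+ c :* c :* (q :* (q :* t)) :+ ((d′ :+ A :* d) :* (q :* (c :* d)) :+ (d′ :+ con 1) :+ A :* A :* (t :* q :+ s :+ con 2 :* y :+ con 1) :+ con 2 :* A :* (d :+ (z :+ y)))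
    := c :* c :* (q :* (q :* t)) :* q :+ (q :* (q :* (c :* c :* s)) :+ q :* (q :* (c :* c)) :+ q :* (con 2 :* c :* z) :+ q :* (con 4 :* h :* (q :* (c :* y)))) :+ con 2 :* (q :* (c :* y)) :+ con 1
       :+ ((d′ :+ A :* d) :* (d′ :+ con 1) :+ q :* (c :* d) :+ A :* A :* (d :* d :+ t) :+ con 2 :* A :* (con 2 :* q :* y))) refl q h d d′ z y s t

-- 2 ^ (3 + n) is the factor c of D-suc from index 1 + n to 2 + n, and c = 2 (h + 1).
Spoly : ℕ → Poly
Spoly zero    = []
Spoly (suc n) = (0 ∷ 0 ∷ scale (c * c) (Spoly n)) ⊕ (0 ∷ 0 ∷ c * c ∷ [])
              ⊕ (0 ∷ scale (2 * c) (Zpoly (suc n))) ⊕ (0 ∷ scale (4 * h) (Ypoly (suc (suc n))))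
  where
  c = 2 ^ (3 + n)
  h = 2 ^ (2 + n) ∸ 1

Rpoly : ℕ → Poly
Rpoly n = Spoly n ⊕ scale 2 (Ypoly (suc n))

S : ℕ → ℕ → ℕ
S k n = ⟦ Spoly n ⟧ (2 ^ k)

R : ℕ → ℕ → ℕ
R k n = ⟦ Rpoly n ⟧ (2 ^ k)

T : ℕ → ℕ → ℕ
T k n = 4 * 2 ^ k * (Y k (suc n) * Y k (suc n))

R≡S+2Y : ∀ k n → R k n ≡ S k n + 2 * Y k (suc n)
R≡S+2Y k n = trans (⟦⊕⟧ (Spoly n) (scale 2 (Ypoly (suc n))) (2 ^ k)) (cong (S k n +_) (⟦scale⟧ 2 (Ypoly (suc n)) (2 ^ k)))

S-suc : ∀ k n → let q = 2 ^ k; c = 2 ^ (3 + n); h = 2 ^ (2 + n) ∸ 1 in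
  S k (suc n) ≡ q * (q * (c * c * S k n)) + q * (q * (c * c)) + q * (2 * c * Z k (suc n)) + q * (4 * h * Y k (suc (suc n)))
S-suc k n = begin
  ⟦ A ⊕ A′ ⊕ B′ ⊕ C′ ⟧ q                          ≡⟨ ⟦⊕⟧ (A ⊕ A′ ⊕ B′) C′ q ⟩
  ⟦ A ⊕ A′ ⊕ B′ ⟧ q + ⟦ C′ ⟧ q                   ≡⟨ cong (_+ ⟦ C′ ⟧ q) (⟦⊕⟧ (A ⊕ A′) B′ q) ⟩
  ⟦ A ⊕ A′ ⟧ q + ⟦ B′ ⟧ q + ⟦ C′ ⟧ q              ≡⟨ cong (λ e → e + ⟦ B′ ⟧ q + ⟦ C′ ⟧ q) (⟦⊕⟧ A A′ q) ⟩
  ⟦ A ⟧ q + ⟦ A′ ⟧ q + ⟦ B′ ⟧ q + ⟦ C′ ⟧ q        ≡⟨ cong₃ (λ a b e → q * (0 + q * a) + ⟦ A′ ⟧ q + q * b + q * e)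
                                                     (⟦scale⟧ (c * c) (Spoly n) q) (⟦scale⟧ (2 * c) (Zpoly (suc n)) q) (⟦scale⟧ (4 * h) (Ypoly (suc (suc n))) q) ⟩
  q * (0 + q * (c * c * S k n)) + q * (0 + q * (c * c + q * 0)) + q * (2 * c * Z k (suc n)) + q * (4 * h * Y k (suc (suc n)))
                                                  ≡⟨ solve 6 (λ q c s z y h → q :* (con 0 :+ q :* (c :* c :* s)) :+ q :* (con 0 :+ q :* (c :* c :+ q :* con 0)) :+ q :* (con 2 :* c :* z) :+ q :* (con 4 :* h :* y)
                                                       := q :* (q :* (c :* c :* s)) :+ q :* (q :* (c :* c)) :+ q :* (con 2 :* c :* z) :+ q :* (con 4 :* h :* y)) refl q c (S k n) (Z k (suc n)) (Y k (suc (suc n))) h ⟩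
  q * (q * (c * c * S k n)) + q * (q * (c * c)) + q * (2 * c * Z k (suc n)) + q * (4 * h * Y k (suc (suc n))) ∎
  where
  open ≡-Reasoning
  q = 2 ^ k
  c = 2 ^ (3 + n)
  h = 2 ^ (2 + n) ∸ 1
  A = 0 ∷ 0 ∷ scale (c * c) (Spoly n)
  A′ = 0 ∷ 0 ∷ c * c ∷ []
  B′ = 0 ∷ scale (2 * c) (Zpoly (suc n))
  C′ = 0 ∷ scale (4 * h) (Ypoly (suc (suc n)))
  cong₃ : ∀ (f : ℕ → ℕ → ℕ → ℕ) {a a′ b b′ e e′} → a ≡ a′ → b ≡ b′ → e ≡ e′ → f a b e ≡ f a′ b′ e′
  cong₃ f refl refl refl = refl

T-suc : ∀ k n → let q = 2 ^ k; c = 2 ^ (3 + n) in T k (suc n) ≡ c * c * (q * (q * T k n))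
T-suc k n = begin
  4 * q * (Y k (2 + n) * Y k (2 + n))              ≡⟨ cong (λ y → 4 * q * (y * y)) (Y-suc k (suc n)) ⟩
  4 * q * (q * (c * y) * (q * (c * y)))            ≡⟨ solve 3 (λ q c y → con 4 :* q :* (q :* (c :* y) :* (q :* (c :* y))) := c :* c :* (q :* (q :* (con 4 :* q :* (y :* y))))) refl q c y ⟩
  c * c * (q * (q * T k n))                        ∎
  where
  open ≡-Reasoning
  q = 2 ^ k
  c = 2 ^ (3 + n)
  y = Y k (suc n)

-- D k (1 + n) ² − 1 = T k n · (q − 1) + R k n, written without subtraction.
D²+T≡T*q+S+2Y+1 : ∀ k n → D k (suc n) * D k (suc n) + T k n ≡ T k n * 2 ^ k + S k n + 2 * Y k (suc n) + 1
D²+T≡T*q+S+2Y+1 k zero =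
  square-base-identity (2 ^ k) (D k 0) (D k 1) (Y k 1) (D-zero k) (D-suc k 0)
    (cong (2 ^ k *_) (solve 1 (λ q → con 4 :* con 1 :+ q :* con 0 := con 4) refl (2 ^ k)))
D²+T≡T*q+S+2Y+1 k (suc n) = begin
  D k (2 + n) * D k (2 + n) + T k (suc n)            ≡⟨ cong (D k (2 + n) * D k (2 + n) +_) (T-suc k n) ⟩
  D k (2 + n) * D k (2 + n) + c * c * (q * (q * T k n))
    ≡⟨ square-step-identity q c h (D k (suc n)) (D k (2 + n)) (Z k (suc n)) (Y k (suc n)) (S k n) (T k n)
         c≡2[h+1] (D-suc k (suc n)) (D+Z+Y≡2qY k (suc n)) (D²+T≡T*q+S+2Y+1 k n) ⟩
  c * c * (q * (q * T k n)) * q + (q * (q * (c * c * S k n)) + q * (q * (c * c)) + q * (2 * c * Z k (suc n)) + q * (4 * h * (q * (c * Y k (suc n))))) + 2 * (q * (c * Y k (suc n))) + 1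
    ≡⟨ cong₂ (λ t y → t * q + (q * (q * (c * c * S k n)) + q * (q * (c * c)) + q * (2 * c * Z k (suc n)) + q * (4 * h * y)) + 2 * y + 1) (T-suc k n) (Y-suc k (suc n)) ⟨
  T k (suc n) * q + (q * (q * (c * c * S k n)) + q * (q * (c * c)) + q * (2 * c * Z k (suc n)) + q * (4 * h * Y k (2 + n))) + 2 * Y k (2 + n) + 1
    ≡⟨ cong (λ s → T k (suc n) * q + s + 2 * Y k (2 + n) + 1) (S-suc k n) ⟨
  T k (suc n) * q + S k (suc n) + 2 * Y k (2 + n) + 1 ∎
  where
  open ≡-Reasoning
  q = 2 ^ k
  c = 2 ^ (3 + n)
  h = 2 ^ (2 + n) ∸ 1
  c≡2[h+1] : c ≡ 2 * (h + 1)
  c≡2[h+1] = cong (2 *_) (sym (m∸n+n≡m (m^n>0 2 (2 + n))))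

D²+T≡T*q+R+1 : ∀ k n → D k (suc n) * D k (suc n) + T k n ≡ T k n * 2 ^ k + R k n + 1
D²+T≡T*q+R+1 k n = begin
  D k (suc n) * D k (suc n) + T k n                    ≡⟨ D²+T≡T*q+S+2Y+1 k n ⟩
  T k n * 2 ^ k + S k n + 2 * Y k (suc n) + 1          ≡⟨ cong (_+ 1) (+-assoc (T k n * 2 ^ k) (S k n) _) ⟩
  T k n * 2 ^ k + (S k n + 2 * Y k (suc n)) + 1        ≡⟨ cong (λ r → T k n * 2 ^ k + r + 1) (R≡S+2Y k n) ⟨
  T k n * 2 ^ k + R k n + 1                            ∎
  where open ≡-Reasoning

T-power-of-2 : ∀ k n → ∃ λ τ → T k n ≡ 2 ^ τ
T-power-of-2 k n with Y-power-of-2 k (suc n)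
... | e , Y≡2^e = 2 + (k + (e + e)) , (begin
  4 * 2 ^ k * (Y k (suc n) * Y k (suc n)) ≡⟨ cong (λ y → 4 * 2 ^ k * (y * y)) Y≡2^e ⟩
  4 * 2 ^ k * (2 ^ e * 2 ^ e)             ≡⟨ cong (λ y → 4 * 2 ^ k * y) (^-distribˡ-+-* 2 e e) ⟨
  4 * 2 ^ k * 2 ^ (e + e)                 ≡⟨ *-assoc 4 (2 ^ k) _ ⟩
  4 * (2 ^ k * 2 ^ (e + e))               ≡⟨ cong (4 *_) (^-distribˡ-+-* 2 k (e + e)) ⟨
  4 * 2 ^ (k + (e + e))                   ≡⟨ solve 1 (λ p → con 4 :* p := con 2 :* (con 2 :* p)) refl (2 ^ (k + (e + e))) ⟩
  2 ^ (2 + (k + (e + e)))                 ∎)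
  where open ≡-Reasoning

D<2qY : ∀ k m → D k m < 2 * 2 ^ k * Y k m
D<2qY k m = begin-strict
  D k m                         <⟨ m<m+n (D k m) (≤-trans Y>0 (m≤n+m (Y k m) (Z k m))) ⟩
  D k m + (Z k m + Y k m)       ≡⟨ D+Z+Y≡2qY k m ⟩
  2 * 2 ^ k * Y k m             ∎
  where
  open ≤-Reasoning
  Y>0 : Y k m > 0
  Y>0 = subst (_> 0) (sym (proj₂ (Y-power-of-2 k m))) (m^n>0 2 (proj₁ (Y-power-of-2 k m)))

-- D < 2 q Y gives D ² < T q, so the remainder R sits below T.
R<T : ∀ k n → R k n < T k n
R<T k n = +-cancelˡ-< (T k n * 2 ^ k) (R k n) (T k n) (begin-strict
  T k n * 2 ^ k + R k n             <⟨ m<m+n _ (s≤s z≤n) ⟩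
  T k n * 2 ^ k + R k n + 1         ≡⟨ D²+T≡T*q+R+1 k n ⟨
  D k (suc n) * D k (suc n) + T k n <⟨ +-monoˡ-< (T k n) (*-mono-< (D<2qY k (suc n)) (D<2qY k (suc n))) ⟩
  2 * q * y * (2 * q * y) + T k n   ≡⟨ cong (_+ T k n) (solve 2 (λ q y → con 2 :* q :* y :* (con 2 :* q :* y) := con 4 :* q :* (y :* y) :* q) refl q y) ⟩
  T k n * q + T k n                 ∎)
  where
  open ≤-Reasoning
  q = 2 ^ k
  y = Y k (suc n)

D²∸1≡[q∸1]*T+R : ∀ k n → D k (suc n) * D k (suc n) ∸ 1 ≡ (2 ^ k ∸ 1) * T k n + R k n
D²∸1≡[q∸1]*T+R k n = +-cancelʳ-≡ (T k n + 1) _ _ (begin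
  d² ∸ 1 + (T k n + 1)               ≡⟨ solve 2 (λ n t → n :+ (t :+ con 1) := n :+ con 1 :+ t) refl (d² ∸ 1) (T k n) ⟩
  d² ∸ 1 + 1 + T k n                 ≡⟨ cong (_+ T k n) (m∸n+n≡m {d²} {1} (s≤s z≤n)) ⟩
  d² + T k n                         ≡⟨ D²+T≡T*q+R+1 k n ⟩
  T k n * 2 ^ k + R k n + 1          ≡⟨ cong (λ q → T k n * q + R k n + 1) (m∸n+n≡m {2 ^ k} {1} (m^n>0 2 k)) ⟨
  T k n * (p + 1) + R k n + 1        ≡⟨ solve 3 (λ t p r → t :* (p :+ con 1) :+ r :+ con 1 := p :* t :+ r :+ (t :+ con 1)) refl (T k n) p (R k n) ⟩
  p * T k n + R k n + (T k n + 1)    ∎)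
  where
  open ≡-Reasoning
  d² = D k (suc n) * D k (suc n)
  p = 2 ^ k ∸ 1

s₂[D²∸1] : ∀ k n → All (_< 2 ^ k) (Rpoly n) → s₂ (D k (suc n) * D k (suc n) ∸ 1) ≡ k + sum (map s₂ (Rpoly n))
s₂[D²∸1] k n coefficients< with T-power-of-2 k n
... | τ , T≡2^τ = begin
  s₂ (D k (suc n) * D k (suc n) ∸ 1)   ≡⟨ cong s₂ (D²∸1≡[q∸1]*T+R k n) ⟩
  s₂ ((2 ^ k ∸ 1) * T k n + R k n)     ≡⟨ cong (λ t → s₂ ((2 ^ k ∸ 1) * t + R k n)) T≡2^τ ⟩
  s₂ ((2 ^ k ∸ 1) * 2 ^ τ + R k n)     ≡⟨ s₂[x*2^t+y]≡s₂[x]+s₂[y] τ (2 ^ k ∸ 1) (R k n) (subst (R k n <_) T≡2^τ (R<T k n)) ⟩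
  s₂ (2 ^ k ∸ 1) + s₂ (R k n)          ≡⟨ cong₂ _+_ (w+1≡2^t⇒s₂[w]≡t k (2 ^ k ∸ 1) (m∸n+n≡m (m^n>0 2 k))) (s₂-⟦⟧ k (Rpoly n) coefficients<) ⟩
  k + sum (map s₂ (Rpoly n))           ∎
  where open ≡-Reasoning

D₀≤2^[m+triangle] : ∀ m → D 0 m ≤ 2 ^ (m + triangle m)
D₀≤2^[m+triangle] zero    = ≤-reflexive (+-cancelʳ-≡ 1 (D 0 0) 1 (D-zero 0))
D₀≤2^[m+triangle] (suc m) = begin
  D 0 (suc m)                              ≤⟨ m≤m+n (D 0 (suc m)) 1 ⟩
  D 0 (suc m) + 1                          ≡⟨ D-suc 0 m ⟩
  1 * (2 ^ (2 + m) * D 0 m)                ≡⟨ *-identityˡ _ ⟩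
  2 ^ (2 + m) * D 0 m                      ≤⟨ *-monoʳ-≤ (2 ^ (2 + m)) (D₀≤2^[m+triangle] m) ⟩
  2 ^ (2 + m) * 2 ^ (m + triangle m)       ≡⟨ ^-distribˡ-+-* 2 (2 + m) (m + triangle m) ⟨
  2 ^ (2 + m + (m + triangle m))           ≡⟨ cong (2 ^_) (solve 2 (λ m t → con 2 :+ m :+ (m :+ t) := (con 1 :+ m) :+ ((con 1 :+ m) :+ t)) refl m (triangle m)) ⟩
  2 ^ (suc m + triangle (suc m))           ∎
  where open ≤-Reasoning

triangle+triangle≡m*[1+m] : ∀ m → triangle m + triangle m ≡ m * suc m
triangle+triangle≡m*[1+m] zero    = refl
triangle+triangle≡m*[1+m] (suc m) = begin
  suc m + triangle m + (suc m + triangle m)   ≡⟨ solve 2 (λ m t → (con 1 :+ m) :+ t :+ ((con 1 :+ m) :+ t) := con 2 :+ con 2 :* m :+ (t :+ t)) refl m (triangle m) ⟩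
  2 + 2 * m + (triangle m + triangle m)       ≡⟨ cong (2 + 2 * m +_) (triangle+triangle≡m*[1+m] m) ⟩
  2 + 2 * m + m * suc m                       ≡⟨ solve 1 (λ m → con 2 :+ con 2 :* m :+ m :* (con 1 :+ m) := (con 1 :+ m) :* (con 2 :+ m)) refl m ⟩
  suc m * suc (suc m)                         ∎
  where open ≡-Reasoning

R₀+1≡D₀² : ∀ n → R 0 n + 1 ≡ D 0 (suc n) * D 0 (suc n)
R₀+1≡D₀² n = +-cancelʳ-≡ (T 0 n) _ _ (begin
  R 0 n + 1 + T 0 n                   ≡⟨ solve 2 (λ r t → r :+ con 1 :+ t := t :* con 1 :+ r :+ con 1) refl (R 0 n) (T 0 n) ⟩
  T 0 n * 1 + R 0 n + 1               ≡⟨ D²+T≡T*q+R+1 0 n ⟨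
  D 0 (suc n) * D 0 (suc n) + T 0 n   ∎)
  where open ≡-Reasoning

-- The coefficients of R n do not depend on k and are bounded by R n evaluated at q = 1 (that is, k = 0).
Rpoly-coefficients<2^k : ∀ n k → 2 * suc n * (suc n + 1) ≤ k → All (_< 2 ^ k) (Rpoly n)
Rpoly-coefficients<2^k n k k≥ = All.map (λ c≤ → <-≤-trans (s≤s c≤) R₀<2^k) (coefficients≤⟦⟧1 (Rpoly n))
  where
  m = suc n
  exponent≤k : (m + triangle m) + (m + triangle m) ≤ k
  exponent≤k = begin
    (m + triangle m) + (m + triangle m)   ≡⟨ solve 2 (λ m t → (m :+ t) :+ (m :+ t) := m :* con 2 :+ (t :+ t)) refl m (triangle m) ⟩
    m * 2 + (triangle m + triangle m)     ≡⟨ cong (m * 2 +_) (triangle+triangle≡m*[1+m] m) ⟩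
    m * 2 + m * suc m                     ≤⟨ +-monoˡ-≤ (m * suc m) (*-monoʳ-≤ m (s≤s (s≤s z≤n))) ⟩
    m * suc m + m * suc m                 ≡⟨ solve 1 (λ m → m :* (con 1 :+ m) :+ m :* (con 1 :+ m) := con 2 :* m :* (m :+ con 1)) refl m ⟩
    2 * m * (m + 1)                       ≤⟨ k≥ ⟩
    k                                     ∎
    where open ≤-Reasoning
  R₀<2^k : suc (R 0 n) ≤ 2 ^ k
  R₀<2^k = begin
    suc (R 0 n)                                   ≡⟨ +-comm 1 (R 0 n) ⟩
    R 0 n + 1                                     ≡⟨ R₀+1≡D₀² n ⟩
    D 0 m * D 0 m                                 ≤⟨ *-mono-≤ (D₀≤2^[m+triangle] m) (D₀≤2^[m+triangle] m) ⟩
    2 ^ (m + triangle m) * 2 ^ (m + triangle m)   ≡⟨ ^-distribˡ-+-* 2 (m + triangle m) (m + triangle m) ⟨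
    2 ^ ((m + triangle m) + (m + triangle m))     ≤⟨ ^-monoʳ-≤ 2 exponent≤k ⟩
    2 ^ k                                         ∎
    where open ≤-Reasoning

-- The square of u

square-pred-identity : ∀ x d P N W → x + 1 ≡ d * (2 * P) → W + d ≡ P → N + 1 ≡ d * d →
  x * x ≡ (N * P + W) * (2 * (2 * P)) + 1
square-pred-identity x d P N W h₁ h₂ h₃ = +-cancel {x = X} {y = X′} polynomial (swap h₁ h₂ h₃)
  where
  A = x + 2 * d * P
  X = A * (d * (2 * P)) + (x + 1) + 4 * P * P * (N + 1) + 4 * P * (W + d)
  X′ = A * (x + 1) + d * (2 * P) + 4 * P * P * (d * d) + 4 * P * P
  swap : ∀ {l₁ r₁ l₂ r₂ l₃ r₃} → l₁ ≡ r₁ → l₂ ≡ r₂ → l₃ ≡ r₃ →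
    A * r₁ + l₁ + 4 * P * P * l₃ + 4 * P * l₂ ≡ A * l₁ + r₁ + 4 * P * P * r₃ + 4 * P * r₂
  swap refl refl refl = refl
  polynomial : x * x + X ≡ (N * P + W) * (2 * (2 * P)) + 1 + X′
  polynomial = solve 5 (λ x d P N W →
    let A = x :+ con 2 :* d :* P in
    x :* x :+ (A :* (d :* (con 2 :* P)) :+ (x :+ con 1) :+ con 4 :* P :* P :* (N :+ con 1) :+ con 4 :* P :* (W :+ d))
    := (N :* P :+ W) :* (con 2 :* (con 2 :* P)) :+ con 1 :+ (A :* (x :+ con 1) :+ d :* (con 2 :* P) :+ con 4 :* P :* P :* (d :* d) :+ con 4 :* P :* P)) refl x d P N W

-- For x = d · 2 ^ (1 + t) − 1 with d ≤ 2 ^ t the square is x ² = ((d ² − 1) · 2 ^ t + (2 ^ t − d)) · 2 ^ (2 + t) + 1,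
-- and 2 ^ t − d is the t-bit complement of d − 1.
s₂[x²]+s₂[d∸1] : ∀ t x b → x + 1 ≡ suc b * 2 ^ suc t → suc b ≤ 2 ^ t →
  s₂ (x * x) + s₂ b ≡ suc t + s₂ (suc b * suc b ∸ 1)
s₂[x²]+s₂[d∸1] t x b x+1≡ d≤P = begin
  s₂ (x * x) + s₂ b                              ≡⟨ cong (λ y → s₂ y + s₂ b) (square-pred-identity x d P N W x+1≡ W+d≡P N+1≡d²) ⟩
  s₂ ((N * P + W) * 2 ^ suc (suc t) + 1) + s₂ b  ≡⟨ cong (_+ s₂ b) (s₂[x*2^t+y]≡s₂[x]+s₂[y] (suc (suc t)) (N * P + W) 1 (*-monoʳ-≤ 2 (m^n>0 2 (suc t)))) ⟩
  s₂ (N * P + W) + 1 + s₂ b                      ≡⟨ cong (λ y → y + 1 + s₂ b) (s₂[x*2^t+y]≡s₂[x]+s₂[y] t N W W<P) ⟩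
  s₂ N + s₂ W + 1 + s₂ b                         ≡⟨ solve 3 (λ n w b → n :+ w :+ con 1 :+ b := con 1 :+ (b :+ w) :+ n) refl (s₂ N) (s₂ W) (s₂ b) ⟩
  suc (s₂ b + s₂ W) + s₂ N                       ≡⟨ cong (λ y → suc y + s₂ N) (b+w+1≡2^t⇒s₂[b]+s₂[w]≡t t b W b+W+1≡P) ⟩
  suc t + s₂ N                                   ∎
  where
  open ≡-Reasoning
  d = suc b
  P = 2 ^ t
  N = d * d ∸ 1
  W = P ∸ d
  W+d≡P : W + d ≡ P
  W+d≡P = m∸n+n≡m d≤P
  N+1≡d² : N + 1 ≡ d * d
  N+1≡d² = m∸n+n≡m (s≤s z≤n)
  W<P : W < P
  W<P = subst (W <_) W+d≡P (subst (_≤ W + d) (+-comm W 1) (+-monoʳ-≤ W (s≤s z≤n)))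
  b+W+1≡P : b + W + 1 ≡ P
  b+W+1≡P = trans (solve 2 (λ b w → b :+ w :+ con 1 := w :+ (con 1 :+ b)) refl b W) W+d≡P

s₂[u] : ∀ k m n → s₂ (u k m n) ≡ n + k * (m + 1) + triangle m
s₂[u] k m n = begin
  s₂ (u k m n)                                     ≡⟨ cong s₂ (u≡B*2^n+ones k m n) ⟩
  s₂ (B k m * 2 ^ n + fromBits (replicate n true)) ≡⟨ s₂[x*2^t+y]≡s₂[x]+s₂[y] n (B k m) _ ones<2^n ⟩
  s₂ (B k m) + s₂ (fromBits (replicate n true))    ≡⟨ cong₂ _+_ (s₂-B k m) (s₂-fromBits-ones n) ⟩
  suc m * k + triangle m + n                       ≡⟨ solve 4 (λ m k t n → (con 1 :+ m) :* k :+ t :+ n := n :+ k :* (m :+ con 1) :+ t) refl m k (triangle m) n ⟩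
  n + k * (m + 1) + triangle m                     ∎
  where
  open ≡-Reasoning
  ones<2^n : fromBits (replicate n true) < 2 ^ n
  ones<2^n = subst (fromBits (replicate n true) <_) (fromBits-ones n) (m<m+n _ (s≤s z≤n))

s₂[u²] : ∀ m k n → 2 * suc m * (suc m + 1) ≤ k → length (blocks k (suc m)) ≤ n →
  s₂ (u k (suc m) (suc n) * u k (suc m) (suc n)) + (suc m * k + triangle (suc m)) ≡ suc n + sum (map s₂ (Rpoly m))
s₂[u²] m k n k≥ length≤n = +-cancelˡ-≡ k _ _ (begin
  k + (s₂ (x * x) + (suc m * k + triangle (suc m)))   ≡⟨ solve 4 (λ k a b t → k :+ (a :+ (b :+ t)) := a :+ (k :+ b :+ t)) refl k (s₂ (x * x)) (suc m * k) (triangle (suc m)) ⟩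
  s₂ (x * x) + (suc (suc m) * k + triangle (suc m))   ≡⟨ cong (s₂ (x * x) +_) (s₂-B k (suc m)) ⟨
  s₂ (x * x) + s₂ (B k (suc m))                       ≡⟨ s₂[x²]+s₂[d∸1] n x (B k (suc m)) (u+1≡D*2^n k (suc m) (suc n)) D≤2^n ⟩
  suc n + s₂ (D k (suc m) * D k (suc m) ∸ 1)          ≡⟨ cong (suc n +_) (s₂[D²∸1] k m (Rpoly-coefficients<2^k m k k≥)) ⟩
  suc n + (k + σ)                                     ≡⟨ solve 3 (λ n k s → n :+ (k :+ s) := k :+ (n :+ s)) refl (suc n) k σ ⟩
  k + (suc n + σ)                                     ∎)
  where
  open ≡-Reasoning
  x = u k (suc m) (suc n)
  σ = sum (map s₂ (Rpoly m))
  D≤2^n : D k (suc m) ≤ 2 ^ n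
  D≤2^n = ≤-trans (fromBits<2^length (blocks k (suc m))) (^-monoʳ-≤ 2 length≤n)

-- Imported only here: the constructor +_ would make sections such as (n % 2 +_) above ambiguous.
open import Data.Integer using (ℤ; +_; _-_) renaming (_+_ to _+ℤ_)
open import Data.Integer.Properties using (pos-+)
import Data.Integer.Solver as ℤ-Solver

ℕ-sum→ℤ-difference : ∀ a b c d e → a + (b + c) ≡ d + e → + a ≡ + d - + b +ℤ (+ e - + c)
ℕ-sum→ℤ-difference a b c d e eq = begin
  + a                                  ≡⟨ Z.solve 3 (λ a b c → a Z.:= a Z.:+ (b Z.:+ c) Z.:- (b Z.:+ c)) refl (+ a) (+ b) (+ c) ⟩
  + a +ℤ (+ b +ℤ + c) - (+ b +ℤ + c)   ≡⟨ cong (_- (+ b +ℤ + c)) lifted ⟩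
  + d +ℤ + e - (+ b +ℤ + c)            ≡⟨ Z.solve 4 (λ b c d e → d Z.:+ e Z.:- (b Z.:+ c) Z.:= d Z.:- b Z.:+ (e Z.:- c)) refl (+ b) (+ c) (+ d) (+ e) ⟩
  + d - + b +ℤ (+ e - + c)             ∎
  where
  open ≡-Reasoning
  module Z = ℤ-Solver.+-*-Solver
  lifted : + a +ℤ (+ b +ℤ + c) ≡ + d +ℤ + e
  lifted = begin
    + a +ℤ (+ b +ℤ + c)  ≡⟨ cong (+ a +ℤ_) (pos-+ b c) ⟨
    + a +ℤ + (b + c)     ≡⟨ pos-+ a (b + c) ⟨
    + (a + (b + c))      ≡⟨ cong +_ eq ⟩
    + (d + e)            ≡⟨ pos-+ d e ⟩
    + d +ℤ + e           ∎

+[a+b+c]≡+a+b+c : ∀ a b c → + (a + b + c) ≡ + a +ℤ + b +ℤ + c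
+[a+b+c]≡+a+b+c a b c = trans (pos-+ (a + b) c) (cong (_+ℤ + c) (pos-+ a b))

theorem2p1 : (m : ℕ) → 1 ≤ m →
    Σ ℕ (λ d → (0 < d) × Σ ℤ (λ e₁ → Σ ℤ (λ e₂ →
    (k n : ℕ) → 1 ≤ k → 1 ≤ n →
    2 * m * (m + 1) ∸ 1 < k → (m + 1) * k + d < n →
    ((+ s₂ (u k m n * u k m n)) ≡ (+ n) - (+ (m * k)) Data.Integer.+ e₁)
    × ((+ s₂ (u k m n)) ≡ (+ n) Data.Integer.+ (+ (k * (m + 1))) Data.Integer.+ e₂))))
theorem2p1 m@(suc m₀) _ =
  suc m + triangle m , s≤s z≤n , + σ - + triangle m , + triangle m ,
  λ { k (suc n) _ _ k≥ (s≤s n≥) →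
        ℕ-sum→ℤ-difference _ (m * k) (triangle m) (suc n) σ (s₂[u²] m₀ k n k≥ (length≤ k n n≥))
      , trans (cong +_ (s₂[u] k m (suc n))) (+[a+b+c]≡+a+b+c (suc n) (k * (m + 1)) (triangle m)) }
  where
  σ = sum (map s₂ (Rpoly m₀))
  length≤ : ∀ k n → (m + 1) * k + (suc m + triangle m) ≤ n → length (blocks k m) ≤ n
  length≤ k n = subst (_≤ n) (trans (cong (λ i → i * k + (suc m + triangle m)) (+-comm m 1)) (sym (length-blocks k m)))
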